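{- For every finite undirected graph $G=(V,E)$ there exists a valid colouring $c$ of $G$ such that $\operatorname{loc}(G,c)=\gamma(G)$, where $\gamma(G)$ is the number of connected components of $G$.
   Context: A colouring of $G=(V,E)$ is a function $c:V\to[\ell]$ for some $\ell\in\mathbb{N}$; it is valid if adjacent vertices get distinct colours. Let $\mathcal C(G,c)=c(V)$, $m=|\mathcal C(G,c)|$. A marking sequence is an enumeration $e=(x_1,\dots,x_m)$ of $\mathcal C(G,c)$. For $i\in[m]$ let $G_i$ be the subgraph of $G$ induced by the vertices whose colour lies in $\{x_1,\dots,x_i\}$. With $\gamma(H)$ the number of connected components of $H$, set $\operatorname{loc}(G,c,e)=\max_{i\in[m]}\gamma(G_i)$ and $\operatorname{loc}(G,c)=\min_e\operatorname{loc}(G,c,e)$. -}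

module Defs where

open import Data.Nat using (ℕ; zero; suc; _≤_; _⊔_; _<ᵇ_)
open import Data.Bool using (Bool; true; false; _∧_; _∨_; not; T)
open import Data.Fin using (Fin; toℕ)
open import Data.Fin.Properties using (_≟_)
open import Data.Bool.ListAction using (any; all)
open import Data.List using (List; allFin; filterᵇ; length; take; map; upTo; foldr)
open import Data.List.Relation.Unary.Unique.Propositional using (Unique)
open import Data.List.Membership.Propositional using (_∈_)
open import Data.Product using (Σ; _×_; ∃)
open import Function.Bundles using (_⇔_)
open import Relation.Nullary.Decidable using (⌊_⌋)
open import Relation.Binary.PropositionalEquality using (_≡_)

record Graph (n : ℕ) : Set where
  field
    adj   : Fin n → Fin n → Bool
    sym   : ∀ u v → adj u v ≡ adj v u
    irrefl : ∀ v → adj v v ≡ false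
open Graph public

VSet : ℕ → Set
VSet n = Fin n → Bool

module _ {n : ℕ} (G : Graph n) where

  -- reachK S k u v : there is a walk of length ≤ k from u to v
  -- using only vertices of S (in the subgraph of G induced by S).
  reachK : VSet n → ℕ → Fin n → Fin n → Bool
  reachK S zero    u v = S u ∧ ⌊ u ≟ v ⌋
  reachK S (suc k) u v =
    reachK S k u v ∨ any (λ w → reachK S k u w ∧ (S v ∧ adj G w v)) (allFin n)

  -- u and v lie in the same connected component of G[S]
  -- (walks of length ≤ n suffice in a graph with n vertices).
  connected : VSet n → Fin n → Fin n → Bool
  connected S u v = reachK S n u v

  -- γ(G[S]): number of connected components of the induced subgraph G[S],
  -- counted as the number of vertices of S that are the least vertex
  -- (in the order of Fin n) of their component.
  γ : VSet n → ℕ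
  γ S = length (filterᵇ isLeader (allFin n))
    where
      isLeader : Fin n → Bool
      isLeader v = S v ∧ all (λ u → not ((toℕ u <ᵇ toℕ v) ∧ connected S u v)) (allFin n)

  γG : ℕ
  γG = γ (λ _ → true)

  Valid : {ℓ : ℕ} → (Fin n → Fin ℓ) → Set
  Valid c = ∀ u v → T (adj G u v) → c u ≡ c v → Data.Empty.⊥
    where import Data.Empty

  IsMarking : {ℓ : ℕ} → (Fin n → Fin ℓ) → List (Fin ℓ) → Set
  IsMarking c e = Unique e × (∀ x → (x ∈ e) ⇔ (∃ λ v → c v ≡ x))

  Gi : {ℓ : ℕ} → (Fin n → Fin ℓ) → List (Fin ℓ) → ℕ → VSet n
  Gi c e i v = any (λ x → ⌊ c v ≟ x ⌋) (take i e)

  -- loc(G,c,e) = max_{i ∈ [m]} γ(G_i)  (m = length e; max of empty = 0)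
  locSeq : {ℓ : ℕ} → (Fin n → Fin ℓ) → List (Fin ℓ) → ℕ
  locSeq c e = foldr _⊔_ 0 (map (λ j → γ (Gi c e (suc j))) (upTo (length e)))

  IsLoc : {ℓ : ℕ} → (Fin n → Fin ℓ) → ℕ → Set
  IsLoc c k =
    (Σ (List _) λ e → IsMarking c e × locSeq c e ≡ k)
    × (∀ e → IsMarking c e → k ≤ locSeq c e)

-- Give every vertex its own colour and mark the vertices in order of their
-- distance from the least vertex of their component (its leader). Every marked
-- set is then closed under passing to a vertex of smaller depth, so a shortest
-- walk from the leader to a marked vertex stays inside the marked set. Hence the
-- least vertex of each component of G_i is the leader of a component of G, and
-- γ(G_i) ≤ γ(G); the last G_i is G itself.

module Submission where

open import Defs hiding (sym)
open import Data.Nat as ℕ using (ℕ; zero; suc; z≤n; s≤s; _+_; _*_; _⊔_; _<ᵇ_)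
open import Data.Nat.Properties
  using ( ≤-refl; ≤-reflexive; ≤-trans; ≤-antisym; ≤-<-trans; ≤-pred; ≤∧≢⇒<; <⇒≱; ≮⇒≥; n≤1+n; m≤n+m
        ; m≤n⇒m≤1+n; n≤0⇒n≡0; m≤n⇒m<n∨m≡n; n<1+n; <ᵇ⇒<; <⇒<ᵇ; ⊔-lub; m≤n⇒m≤n⊔o; m≤n⇒m≤o⊔n )
open import Data.Bool using (Bool; true; false; T; not; _∧_)
open import Data.Bool.Properties using (T?; T-∧; T-∨)
open import Data.Bool.ListAction using (all)
open import Data.Fin as Fin using (Fin; toℕ; fromℕ; fromℕ<; combine)
open import Data.Fin.Properties
  using ( _≟_; any?; all?; ¬∀⟶∃¬; ¬∀⟶∃¬-smallest; toℕ-injective; toℕ-inject; toℕ-fromℕ; toℕ-fromℕ<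
        ; toℕ≤pred[n]; <-asym; <⇒≢; combine-injective; combine-monoˡ-< )
  renaming (≤-antisym to ≤ᶠ-antisym)
open import Data.List using (List; []; _∷_; filter; filterᵇ; length; take; map; upTo; allFin)
open import Data.List.Properties
  using (length-filter; length-tabulate; filter-some; take-all; foldr-preservesᵇ; foldr-preservesᵒ)
open import Data.List.Membership.Propositional using (_∈_; lose)
open import Data.List.Membership.Propositional.Properties
  using (∈-allFin; ∈-filter⁺; ∈-filter⁻; ∈-upTo⁺)
open import Data.List.Relation.Unary.Any as Any using (here; there; satisfied)
import Data.List.Relation.Unary.Any.Properties as Any
open import Data.List.Relation.Unary.All as All using ()
import Data.List.Relation.Unary.All.Properties as All
open import Data.List.Relation.Unary.AllPairs as AllPairs using (AllPairs; _∷_)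
import Data.List.Relation.Unary.AllPairs.Properties as AllPairs
open import Data.List.Relation.Binary.Sublist.Propositional using (_⊆_; ⊆-refl)
open import Data.List.Relation.Binary.Sublist.Propositional.Properties
  using (filter⁺; length-mono-≤; to-≋)
open import Data.List.Relation.Binary.Pointwise using (Pointwise-≡⇒≡)
open import Data.Product using (Σ; ∃; _×_; _,_; proj₁; proj₂)
open import Data.Sum using (_⊎_; inj₁; inj₂; [_,_])
open import Data.Unit using (tt)
open import Data.Empty using (⊥-elim)
open import Function using (id; _∘_)
open import Function.Bundles using (Equivalence; mk⇔)
open import Relation.Nullary using (¬_; Dec; yes; no; ¬?)
open import Relation.Nullary.Decidable using (decidable-stable; toWitness; fromWitness; _→-dec_)
open import Relation.Unary using (Decidable)
open import Relation.Binary.Definitions using (Asymmetric)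
open import Relation.Binary.PropositionalEquality using (_≡_; refl; sym; trans; subst)

open Equivalence using (to; from)

T-not⁺ : ∀ {b} → ¬ T b → T (not b)
T-not⁺ {false} _  = _
T-not⁺ {true}  ¬b = ¬b _

T-not⁻ : ∀ {b} → T (not b) → ¬ T b
T-not⁻ {false} _ ()

module _ {A : Set} {p q : A → Bool} (p⇒q : ∀ {x} → T (p x) → T (q x)) where

  filterᵇ-⊆ : ∀ xs → filterᵇ p xs ⊆ filterᵇ q xs
  filterᵇ-⊆ xs = filter⁺ (λ x → T? (p x)) (λ x → T? (q x)) (λ { refl → p⇒q }) (⊆-refl {x = xs})

  length-filterᵇ-mono : ∀ xs → length (filterᵇ p xs) ℕ.≤ length (filterᵇ q xs)
  length-filterᵇ-mono xs = length-mono-≤ (filterᵇ-⊆ xs)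

  length-filterᵇ-< : ∀ {x xs} → x ∈ xs → T (q x) → ¬ T (p x) →
                     length (filterᵇ p xs) ℕ.< length (filterᵇ q xs)
  length-filterᵇ-< {x} {xs} x∈xs qx ¬px = ≤∧≢⇒< (length-filterᵇ-mono xs) λ same-length →
    let same = Pointwise-≡⇒≡ (to-≋ same-length (filterᵇ-⊆ xs))
        x∈q  = ∈-filter⁺ (λ y → T? (q y)) x∈xs qx
    in ¬px (proj₂ (∈-filter⁻ (λ y → T? (p y)) {xs = xs} (subst (x ∈_) (sym same) x∈q)))

take-downwardClosed : ∀ {A : Set} {_≺_ : A → A → Set} → Asymmetric _≺_ →
                      ∀ {i x y xs} → AllPairs _≺_ xs → y ∈ take i xs → x ∈ xs → x ≺ y → x ∈ take i xs
take-downwardClosed asym {suc i} (_ ∷ _)      _           (here refl) _   = here refl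
take-downwardClosed asym {suc i} (z≺ ∷ _)     (here refl) (there x∈)  x≺z =
  ⊥-elim (asym (All.lookup z≺ x∈) x≺z)
take-downwardClosed asym {suc i} (_ ∷ sorted) (there y∈)  (there x∈)  x≺y =
  there (take-downwardClosed asym sorted y∈ x∈ x≺y)

smallest : ∀ {n} (p : Fin n → Bool) {j} → T (p j) →
           ∃ λ i → T (p i) × (∀ {u} → T (p u) → i Fin.≤ u)
smallest p {j} pj with ¬∀⟶∃¬-smallest _ (λ i → ¬ T (p i)) (λ i → ¬? (T? (p i))) (λ none → none j pj)
... | i , ¬¬pi , below = i , decidable-stable (T? (p i)) ¬¬pi , λ {u} pu → ≮⇒≥ λ u<i →
  below (fromℕ< u<i) (subst (T ∘ p) (sym (toℕ-injective (trans (toℕ-inject _) (toℕ-fromℕ< u<i)))) pu)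

module _ {n : ℕ} (G : Graph n) where

  -- Walks in G[S] of length at most k, not exactly k.
  data Walk (S : VSet n) : ℕ → Fin n → Fin n → Set where
    nil  : ∀ {k u} → T (S u) → Walk S k u u
    snoc : ∀ {k u w v} → Walk S k u w → T (S v) → T (adj G w v) → Walk S (suc k) u v

  module _ {S : VSet n} where

    walk-mono : ∀ {k k′ u v} → k ℕ.≤ k′ → Walk S k u v → Walk S k′ u v
    walk-mono _          (nil su)      = nil su
    walk-mono (s≤s k≤k′) (snoc p sv a) = snoc (walk-mono k≤k′ p) sv a

    walk-weaken : ∀ {k u v} → Walk S k u v → Walk S (suc k) u v
    walk-weaken = walk-mono (n≤1+n _)

    walk-source : ∀ {k u v} → Walk S k u v → T (S u)
    walk-source (nil su)     = su
    walk-source (snoc p _ _) = walk-source p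

    walk-zero : ∀ {u v} → Walk S 0 u v → u ≡ v
    walk-zero (nil _) = refl

    walk-last : ∀ {k u v} → Walk S (suc k) u v → u ≡ v ⊎ ∃ λ w → Walk S k u w × T (adj G w v)
    walk-last (nil _)      = inj₁ refl
    walk-last (snoc p _ a) = inj₂ (_ , p , a)

    walk-cons : ∀ {k x u v} → T (S x) → T (adj G x u) → Walk S k u v → Walk S (suc k) x v
    walk-cons sx a (nil su)      = snoc (nil sx) su a
    walk-cons sx a (snoc p sv b) = snoc (walk-cons sx a p) sv b

    walk-reverse : ∀ {k u v} → Walk S k u v → Walk S k v u
    walk-reverse (nil su)                      = nil su
    walk-reverse {v = v} (snoc {w = w} p sv a) =
      walk-cons sv (subst T (Graph.sym G w v) a) (walk-reverse p)

    walk-++ : ∀ {a b u w v} → Walk S a u w → Walk S b w v → Walk S (b + a) u v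
    walk-++ {a} {b} p (nil _)       = walk-mono (m≤n+m a b) p
    walk-++         p (snoc q sv e) = snoc (walk-++ p q) sv e

    reachK⁺ : ∀ {k u v} → Walk S k u v → T (reachK G S k u v)
    reachK⁺ {zero}  (nil su)              = from T-∧ (su , fromWitness refl)
    reachK⁺ {suc k} (nil su)              = from T-∨ (inj₁ (reachK⁺ {k} (nil su)))
    reachK⁺ {suc k} (snoc {w = w} p sv a) =
      from T-∨ (inj₂ (Any.any⁺ _ (lose (∈-allFin w) (from T-∧ (reachK⁺ p , from T-∧ (sv , a))))))

    reachK⁻ : ∀ {k u v} → T (reachK G S k u v) → Walk S k u v
    reachK⁻ {zero} {u} {v} h with to T-∧ h
    ... | su , u≟v with toWitness {a? = u ≟ v} u≟v
    ... | refl = nil su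
    reachK⁻ {suc k} {u} {v} h with to T-∨ h
    ... | inj₁ shorter = walk-weaken (reachK⁻ shorter)
    ... | inj₂ longer with satisfied (Any.any⁻ (λ w → reachK G S k u w ∧ (S v ∧ adj G w v)) (allFin n) longer)
    ... | w , last with to T-∧ last
    ... | p , sv∧a with to T-∧ sv∧a
    ... | sv , a = snoc (reachK⁻ p) sv a

  walk-⊆ : ∀ {S S′ k u v} → (∀ {x} → T (S x) → T (S′ x)) → Walk S k u v → Walk S′ k u v
  walk-⊆ S⊆S′ (nil su)      = nil (S⊆S′ su)
  walk-⊆ S⊆S′ (snoc p sv a) = snoc (walk-⊆ S⊆S′ p) (S⊆S′ sv) a

  -- The sets of vertices reachable from u within k steps grow with k until they
  -- stabilise, and each strict growth adds a vertex, so they stabilise within n steps.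
  module Shortening (S : VSet n) (u : Fin n) where

    reached : ℕ → ℕ
    reached k = length (filterᵇ (reachK G S k u) (allFin n))

    reached-≤ : ∀ k → reached k ℕ.≤ n
    reached-≤ k = ≤-trans (length-filter _ (allFin n)) (≤-reflexive (length-tabulate id))

    Stable : ℕ → Set
    Stable k = ∀ {v} → Walk S (suc k) u v → Walk S k u v

    stable-absorbs : ∀ {j k v} → Stable j → Walk S k u v → Walk S j u v
    stable-absorbs st (nil su)      = nil su
    stable-absorbs st (snoc p sv a) = st (snoc (stable-absorbs st p) sv a)

    stable-at? : ∀ k v → Dec (T (reachK G S (suc k) u v) → T (reachK G S k u v))
    stable-at? k v = T? _ →-dec T? _

    stable-or-grows : ∀ k → Stable k ⊎ reached k ℕ.< reached (suc k)
    stable-or-grows k with all? (stable-at? k)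
    ... | yes stable = inj₁ λ p → reachK⁻ (stable _ (reachK⁺ p))
    ... | no ¬stable with ¬∀⟶∃¬ n _ (stable-at? k) ¬stable
    ... | v , ¬step with T? (reachK G S (suc k) u v)
    ... | yes new = inj₂ (length-filterᵇ-< (λ old → reachK⁺ (walk-weaken (reachK⁻ {S = S} {k} old)))
                                           (∈-allFin v) new (λ old → ¬step (λ _ → old)))
    ... | no ¬new = ⊥-elim (¬step (λ new → ⊥-elim (¬new new)))

    stable-within : T (S u) → ∀ k → (∃ λ j → j ℕ.≤ k × Stable j) ⊎ k ℕ.< reached k
    stable-within su zero    =
      inj₂ (filter-some (λ v → T? (reachK G S 0 u v)) (lose (∈-allFin u) (reachK⁺ {S = S} {0} (nil su))))
    stable-within su (suc k) with stable-within su k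
    ... | inj₁ (j , j≤k , st) = inj₁ (j , m≤n⇒m≤1+n j≤k , st)
    ... | inj₂ k<reached with stable-or-grows k
    ... | inj₁ st    = inj₁ (k , n≤1+n k , st)
    ... | inj₂ grows = inj₂ (≤-trans (s≤s k<reached) grows)

    shorten : ∀ {k v} → Walk S k u v → Walk S n u v
    shorten p with stable-within (walk-source p) n
    ... | inj₁ (j , j≤n , st) = walk-mono j≤n (stable-absorbs st p)
    ... | inj₂ n<reached      = ⊥-elim (<⇒≱ n<reached (reached-≤ n))

  walk-shorten : ∀ {S k u v} → Walk S k u v → Walk S n u v
  walk-shorten {S} {u = u} = Shortening.shorten S u

  IsLeader : VSet n → Fin n → Set
  IsLeader S v = T (S v) × (∀ {u} → u Fin.< v → ¬ Walk S n u v)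

  -- A copy of the where-bound isLeader of γ in Defs: γ G S unfolds to a filter over leader? S.
  leader? : VSet n → Fin n → Bool
  leader? S v = S v ∧ all (λ u → not ((toℕ u <ᵇ toℕ v) ∧ connected G S u v)) (allFin n)

  leader?⁻ : ∀ {S v} → T (leader? S v) → IsLeader S v
  leader?⁻ {S} {v} h with to T-∧ h
  ... | sv , none = sv , λ {u} u<v p →
    T-not⁻ (All.lookup (All.all⁺ _ (allFin n) none) (∈-allFin u)) (from T-∧ (<⇒<ᵇ u<v , reachK⁺ p))

  leader?⁺ : ∀ {S v} → IsLeader S v → T (leader? S v)
  leader?⁺ {S} {v} (sv , none) = from T-∧ (sv , All.all⁻ _ {xs = allFin n} (All.tabulate λ {u} _ →
    T-not⁺ λ h → let u<v , c = to T-∧ h in none (<ᵇ⇒< (toℕ u) (toℕ v) u<v) (reachK⁻ c)))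

  γ-mono : ∀ {S S′} → (∀ {v} → IsLeader S v → IsLeader S′ v) → γ G S ℕ.≤ γ G S′
  γ-mono S⇒S′ = length-filterᵇ-mono (λ h → leader?⁺ (S⇒S′ (leader?⁻ h))) (allFin n)

  full : VSet n
  full _ = true

  γG-≤-γ : ∀ {S} → (∀ v → T (S v)) → γG G ℕ.≤ γ G S
  γG-≤-γ total = γ-mono λ {v} (_ , none) → total v , λ u<v c → none u<v (walk-⊆ _ c)

  _∼_ : Fin n → Fin n → Set
  u ∼ v = Walk full n u v

  ∼-trans : ∀ {u w v} → u ∼ w → w ∼ v → u ∼ v
  ∼-trans p q = walk-shorten (walk-++ p q)

  ∼-edge : ∀ {w v} → T (adj G w v) → w ∼ v
  ∼-edge a = walk-shorten (snoc (nil {k = 0} tt) tt a)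

  private
    least-in-component : ∀ v → ∃ λ r → T (connected G full r v) ×
                                       (∀ {u} → T (connected G full u v) → r Fin.≤ u)
    least-in-component v = smallest (λ u → connected G full u v) (reachK⁺ {k = n} (nil tt))

  leader : Fin n → Fin n
  leader v = proj₁ (least-in-component v)

  leader-∼ : ∀ v → leader v ∼ v
  leader-∼ v = reachK⁻ (proj₁ (proj₂ (least-in-component v)))

  leader-≤ : ∀ {u v} → u ∼ v → leader v Fin.≤ u
  leader-≤ {v = v} c = proj₂ (proj₂ (least-in-component v)) (reachK⁺ c)

  leader-cong : ∀ {w v} → w ∼ v → leader w ≡ leader v
  leader-cong {w} {v} c = ≤ᶠ-antisym (leader-≤ (∼-trans (leader-∼ v) (walk-reverse c)))
                                      (leader-≤ (∼-trans (leader-∼ w) c))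

  WalkFromLeader : ℕ → Fin n → Set
  WalkFromLeader k v = Walk full k (leader v) v

  private
    least-depth : ∀ v → ∃ λ d → T (reachK G full (toℕ d) (leader v) v) ×
                                (∀ {j} → T (reachK G full (toℕ j) (leader v) v) → d Fin.≤ j)
    least-depth v = smallest (λ d → reachK G full (toℕ d) (leader v) v) {fromℕ n}
      (reachK⁺ (subst (λ k → WalkFromLeader k v) (sym (toℕ-fromℕ n)) (leader-∼ v)))

  depth : Fin n → Fin (suc n)
  depth v = proj₁ (least-depth v)

  depth-walk : ∀ v → WalkFromLeader (toℕ (depth v)) v
  depth-walk v = reachK⁻ {k = toℕ (depth v)} (proj₁ (proj₂ (least-depth v)))

  depth-minimal : ∀ {k v} → k ℕ.≤ n → WalkFromLeader k v → toℕ (depth v) ℕ.≤ k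
  depth-minimal {k} {v} k≤n p = subst (toℕ (depth v) ℕ.≤_) (toℕ-fromℕ< (s≤s k≤n))
    (proj₂ (proj₂ (least-depth v)) {fromℕ< (s≤s k≤n)}
      (reachK⁺ (subst (λ j → WalkFromLeader j v) (sym (toℕ-fromℕ< (s≤s k≤n))) p)))

  depth-pred : ∀ {k v} → toℕ (depth v) ≡ suc k → ∃ λ w → Walk full k (leader v) w × T (adj G w v)
  depth-pred {k} {v} eq with walk-last (subst (λ j → WalkFromLeader j v) eq (depth-walk v))
  ... | inj₂ pred = pred
  ... | inj₁ leader≡v
    with subst (ℕ._≤ 0) eq (depth-minimal z≤n (subst (λ r → Walk full 0 r v) (sym leader≡v) (nil tt)))
  ... | ()

  DepthClosed : VSet n → Set
  DepthClosed S = ∀ {v w} → T (S v) → depth w Fin.< depth v → T (S w)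

  walk-from-leader : ∀ {S} → DepthClosed S →
                     ∀ k {v} → T (S v) → toℕ (depth v) ℕ.≤ k → Walk S k (leader v) v
  walk-from-leader {S} closed zero {v} sv d≤0 = subst (λ r → Walk S 0 r v) (sym leader≡v) (nil sv)
    where
      leader≡v : leader v ≡ v
      leader≡v = walk-zero (subst (λ j → WalkFromLeader j v) (n≤0⇒n≡0 d≤0) (depth-walk v))
  walk-from-leader {S} closed (suc k) {v} sv d≤1+k with m≤n⇒m<n∨m≡n d≤1+k
  ... | inj₁ d≤k   = walk-weaken (walk-from-leader closed k sv (≤-pred d≤k))
  ... | inj₂ d≡1+k with depth-pred d≡1+k
  ... | w , p , a  = snoc (subst (λ r → Walk S k r w) same-leader (walk-from-leader closed k sw dw≤k)) sv a
    where
      same-leader : leader w ≡ leader v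
      same-leader = leader-cong (∼-edge a)
      dw≤k : toℕ (depth w) ℕ.≤ k
      dw≤k = depth-minimal (≤-trans (n≤1+n k) (subst (ℕ._≤ n) d≡1+k (toℕ≤pred[n] (depth v))))
                           (subst (λ r → Walk full k r w) (sym same-leader) p)
      sw : T (S w)
      sw = closed sv (subst (toℕ (depth w) ℕ.<_) (sym d≡1+k) (s≤s dw≤k))

  leader-of-depthClosed : ∀ {S v} → DepthClosed S → IsLeader S v → IsLeader full v
  leader-of-depthClosed {v = v} closed (sv , none) = tt , λ u<v c →
    none (≤-<-trans (leader-≤ c) u<v)
         (walk-mono (toℕ≤pred[n] (depth v)) (walk-from-leader closed _ sv ≤-refl))

  γ-≤-γG : ∀ {S} → DepthClosed S → γ G S ℕ.≤ γG G
  γ-≤-γG closed = γ-mono (leader-of-depthClosed closed)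

  module _ {ℓ : ℕ} (c : Fin n → Fin ℓ) (e : List (Fin ℓ)) where

    ∈-Gi⁻ : ∀ {i v} → T (Gi G c e i v) → c v ∈ take i e
    ∈-Gi⁻ {i} h = Any.map toWitness (Any.any⁻ _ (take i e) h)

    ∈-Gi⁺ : ∀ {i v} → c v ∈ take i e → T (Gi G c e i v)
    ∈-Gi⁺ m = Any.any⁺ _ (Any.map fromWitness m)

    locSeq-≤ : ∀ {b} → (∀ i → γ G (Gi G c e (suc i)) ℕ.≤ b) → locSeq G c e ℕ.≤ b
    locSeq-≤ {b} bound = foldr-preservesᵇ {P = ℕ._≤ b} {f = _⊔_} ⊔-lub {xs = map _ (upTo (length e))} z≤n
      (All.map⁺ (All.universal bound _))

    γ-≤-locSeq : ∀ {i} → i ℕ.< length e → γ G (Gi G c e (suc i)) ℕ.≤ locSeq G c e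
    γ-≤-locSeq {i} i<m = foldr-preservesᵒ {P = γ G (Gi G c e (suc i)) ℕ.≤_} {f = _⊔_}
      (λ x y → [ m≤n⇒m≤n⊔o y , m≤n⇒m≤o⊔n x ]) 0 _ (inj₂ (Any.map⁺ (lose (∈-upTo⁺ i<m) ≤-refl)))

γG-≤-locSeq : ∀ {n ℓ} (G : Graph n) (c : Fin n → Fin ℓ) (e : List (Fin ℓ)) →
              IsMarking G c e → γG G ℕ.≤ locSeq G c e
γG-≤-locSeq {zero}  G c []         _                    = z≤n
γG-≤-locSeq {suc n} G c []         (_ , colours-listed) with from (colours-listed (c Fin.zero)) (Fin.zero , refl)
... | ()
γG-≤-locSeq         G c e@(_ ∷ xs) (_ , colours-listed) =
  ≤-trans (γG-≤-γ G all-listed) (γ-≤-locSeq G c e (n<1+n (length xs)))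
  where
    all-listed : ∀ v → T (Gi G c e (length e) v)
    all-listed v = ∈-Gi⁺ G c e (subst (c v ∈_) (sym (take-all (length e) e ≤-refl))
                                      (from (colours-listed (c v)) (v , refl)))

module Colouring {n : ℕ} (G : Graph n) where

  -- Depth is the high digit, so listing the colours in increasing order marks
  -- the vertices depth by depth.
  colour : Fin n → Fin (suc n * n)
  colour v = combine (depth G v) v

  colour-valid : Valid G colour
  colour-valid u v a eq with combine-injective (depth G u) u (depth G v) v eq
  ... | _ , refl = subst T (Graph.irrefl G u) a

  used? : Decidable (λ x → ∃ λ v → colour v ≡ x)
  used? x = any? (λ v → colour v ≟ x)

  colours : List (Fin (suc n * n))
  colours = filter used? (allFin _)

  colours-sorted : AllPairs Fin._<_ colours
  colours-sorted = AllPairs.filter⁺ used? (AllPairs.tabulate⁺-< id)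

  colours-marking : IsMarking G colour colours
  colours-marking = AllPairs.map <⇒≢ colours-sorted , λ x →
    mk⇔ (proj₂ ∘ ∈-filter⁻ used? {xs = allFin _}) (∈-filter⁺ used? (∈-allFin x))

  Gi-depthClosed : ∀ i → DepthClosed G (Gi G colour colours i)
  Gi-depthClosed i {v} {w} sv dw<dv = ∈-Gi⁺ G colour colours {i}
    (take-downwardClosed <-asym colours-sorted (∈-Gi⁻ G colour colours {i} sv)
      (∈-filter⁺ used? (∈-allFin _) (w , refl)) (combine-monoˡ-< w v dw<dv))

  locSeq-colours-≤-γG : locSeq G colour colours ℕ.≤ γG G
  locSeq-colours-≤-γG = locSeq-≤ G colour colours (λ i → γ-≤-γG G (Gi-depthClosed (suc i)))

proposition8 : (n : ℕ) (G : Graph n) →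
    Σ ℕ λ ℓ → Σ (Fin n → Fin ℓ) λ c → Valid G c × IsLoc G c (γG G)
proposition8 n G =
  suc n * n , colour , colour-valid ,
  (colours , colours-marking , ≤-antisym locSeq-colours-≤-γG (γG-≤-locSeq G colour colours colours-marking)) ,
  γG-≤-locSeq G colour
  where open Colouring G
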